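{- Let $G=(V,E)$ be a twinless strongly connected directed graph, and let $C^{2vt}_{1},C^{2vt}_{2}$ be two distinct $2$-vertex-twinless-connected components of $G$. Then $|C^{2vt}_{1}\cap C^{2vt}_{2}|\le 1$.
   Context: Directed graphs are finite with no loops and no parallel edges. For $U\subseteq V$, $G[U]$ is the induced subgraph. A directed graph is twinless strongly connected if for every pair of vertices $a,b$ there is a directed path $p$ from $a$ to $b$ and a directed path $q$ from $b$ to $a$ such that for every edge $(c,d)$ of $p$, the edge $(d,c)$ is not an edge of $q$. A directed graph $H=(W,F)$ is $2$-vertex-twinless-connected if it is twinless strongly connected, $|W|\ge 3$, and for every $x\in W$ the induced subgraph $H[W\setminus\{x\}]$ is twinless strongly connected. A $2$-vertex-twinless-connected component of $G$ is a maximal set $U\subseteq V$ such that $G[U]$ is $2$-vertex-twinless-connected. -}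

module Defs where

open import Data.Nat using (ℕ; _≤_)
open import Data.Fin using (Fin)
open import Data.Fin.Subset using (Subset; _∈_; _∉_; _⊆_; _-_; ∣_∣)
open import Data.List using (List; []; _∷_)
open import Data.List.Membership.Propositional using () renaming (_∈_ to _∈ₗ_)
open import Data.Product using (Σ; _×_; _,_)
open import Relation.Binary.PropositionalEquality using (_≡_)
open import Relation.Nullary using (¬_)

record Digraph (n : ℕ) : Set₁ where
  field
    Edge   : Fin n → Fin n → Set
    noLoop : ∀ v → ¬ Edge v v
open Digraph public

module _ {n : ℕ} (G : Digraph n) where

  data Path (U : Subset n) : Fin n → Fin n → Set where
    stop : ∀ {a} → a ∈ U → Path U a a
    step : ∀ {a b c} → a ∈ U → Edge G a b → Path U b c → Path U a c

  edges : ∀ {U a b} → Path U a b → List (Fin n × Fin n)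
  edges (stop _) = []
  edges {a = a} (step {b = b} _ _ p) = (a , b) ∷ edges p

  TwinFree : ∀ {U a b} → Path U a b → Path U b a → Set
  TwinFree p q = ∀ c d → (c , d) ∈ₗ edges p → ¬ ((d , c) ∈ₗ edges q)

  TwinlessSC : Subset n → Set
  TwinlessSC U = ∀ a b → a ∈ U → b ∈ U →
    Σ (Path U a b) λ p → Σ (Path U b a) λ q → TwinFree p q

  TwoVTC : Subset n → Set
  TwoVTC U = TwinlessSC U × 3 ≤ ∣ U ∣ × (∀ x → x ∈ U → TwinlessSC (U - x))

  TwoVTCComponent : Subset n → Set
  TwoVTCComponent U = TwoVTC U × (∀ W → U ⊆ W → TwoVTC W → W ≡ U)

module Submission where

-- Write  Linked U a b  for "G[U] has an a→b path p and a b→a path q such that no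
-- edge of p is reversed in q", so that G[U] is twinless strongly connected iff all
-- pairs of vertices of U are linked.  The heart of the proof is that  Linked U  is
-- transitive (Linked-trans).  Given linked pairs (u,v) and (v,w), shorten the u–v
-- paths to simple ones; together they form a closed walk C through u and v that
-- contains no pair of twin edges.  Follow the w→v path only after it LEAVES C for the
-- last time, and the v→w path only until it first ENTERS C; splicing these pieces
-- with a prefix and a suffix of C links u and w (splice).
--
-- Transitivity makes the union of two twinless strongly connected sets with a common
-- vertex twinless strongly connected (TwinlessSC-∪).  If two 2-vertex-twinless-
-- connected sets share two vertices y₁ ≠ y₂, then after deleting any vertex x the two
-- punctured sets still share y₁ or y₂, so their union is again 2-vertex-twinless-
-- connected (TwoVTC-∪).  Maximality of both components then forces C₁ = C₁ ∪ C₂ = C₂.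

open import Defs
open import Data.Nat using (ℕ; _≤_; s≤s)
open import Data.Nat.Properties using (≤-trans; ≰⇒>; _≤?_)
open import Data.Fin using (Fin; _≟_)
import Data.Fin as Fin
open import Data.Fin.Properties using (suc-injective)
open import Data.Fin.Subset
  using (Subset; ⊤; _∈_; _∉_; _⊆_; _∩_; _∪_; _-_; _─_; ⁅_⁆; ∣_∣; inside; outside)
open import Data.Fin.Subset.Properties
  using (_∈?_; x∈p∪q⁻; x∈p∪q⁺; x∈p∩q⁻; p⊆p∪q; q⊆p∪q; ∣p∣≤∣p∪q∣; p─q⊆p;
         x∈p∧x≢y⇒x∈p-y; x∈⁅x⁆)
open import Data.Vec.Base using (_∷_; here; there)
open import Data.List using (List; []; _∷_; _++_)
open import Data.List.Membership.Propositional using () renaming (_∈_ to _∈ₗ_; _∉_ to _∉ₗ_)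
open import Data.List.Membership.Propositional.Properties using (∈-++⁻)
open import Data.List.Relation.Binary.Subset.Propositional using () renaming (_⊆_ to _⊆ₗ_)
open import Data.List.Relation.Binary.Subset.Propositional.Properties
  using (⊆-refl; ⊆-reflexive; ⊆-trans; xs⊆x∷xs; ∷⁺ʳ)
open import Data.List.Relation.Unary.Any using () renaming (here to hereₗ; there to thereₗ)
open import Data.Product using (Σ; _×_; _,_; proj₂)
open import Data.Sum using (_⊎_; inj₁; inj₂)
open import Data.Unit using () renaming (⊤ to Unit; tt to unit)
open import Data.Empty using (⊥-elim)
open import Relation.Nullary using (Dec; yes; no)
open import Relation.Binary.PropositionalEquality
  using (_≡_; _≢_; refl; sym; trans; cong; subst)
open import Function using (id)

module _ {n : ℕ} (G : Digraph n) where

  open import Data.List.Membership.DecPropositional (_≟_ {n}) using ()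
    renaming (_∈?_ to _∈ₗ?_)

  Vertices : Set
  Vertices = List (Fin n)

  Edges : Set
  Edges = List (Fin n × Fin n)

  NoTwins : Edges → Edges → Set
  NoTwins xs ys = ∀ c d → (c , d) ∈ₗ xs → (d , c) ∉ₗ ys

  NoTwins-mono : ∀ {xs ys xs′ ys′} → xs′ ⊆ₗ xs → ys′ ⊆ₗ ys → NoTwins xs ys → NoTwins xs′ ys′
  NoTwins-mono xs′⊆xs ys′⊆ys noTwins c d m m′ = noTwins c d (xs′⊆xs m) (ys′⊆ys m′)

  _++ₚ_ : ∀ {U a b c} → Path G U a b → Path G U b c → Path G U a c
  stop _ ++ₚ q = q
  step a∈U e p ++ₚ q = step a∈U e (p ++ₚ q)

  edges-++ : ∀ {U a b c} (p : Path G U a b) (q : Path G U b c) →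
    edges G (p ++ₚ q) ≡ edges G p ++ edges G q
  edges-++ (stop _) q = refl
  edges-++ (step _ _ p) q = cong (_ ∷_) (edges-++ p q)

  ∈-edges-++⁻ : ∀ {U a b c x} (p : Path G U a b) (q : Path G U b c) →
    x ∈ₗ edges G (p ++ₚ q) → x ∈ₗ edges G p ⊎ x ∈ₗ edges G q
  ∈-edges-++⁻ {x = x} p q m = ∈-++⁻ (edges G p) (subst (x ∈ₗ_) (edges-++ p q) m)

  vertices : ∀ {U a b} → Path G U a b → Vertices
  vertices (stop {a} _) = a ∷ []
  vertices (step {a} _ _ p) = a ∷ vertices p

  start∈vertices : ∀ {U a b} (p : Path G U a b) → a ∈ₗ vertices p
  start∈vertices (stop _) = hereₗ refl
  start∈vertices (step _ _ _) = hereₗ refl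

  source∈vertices : ∀ {U a b c d} (p : Path G U a b) → (c , d) ∈ₗ edges G p → c ∈ₗ vertices p
  source∈vertices (step _ _ p) (hereₗ refl) = hereₗ refl
  source∈vertices (step _ _ p) (thereₗ m) = thereₗ (source∈vertices p m)

  target∈vertices : ∀ {U a b c d} (p : Path G U a b) → (c , d) ∈ₗ edges G p → d ∈ₗ vertices p
  target∈vertices (step _ _ p) (hereₗ refl) = thereₗ (start∈vertices p)
  target∈vertices (step _ _ p) (thereₗ m) = thereₗ (target∈vertices p m)

  vertices-++ʳ : ∀ {U a b c x} (p : Path G U a b) (q : Path G U b c) →
    x ∈ₗ vertices q → x ∈ₗ vertices (p ++ₚ q)
  vertices-++ʳ (stop _) q m = m
  vertices-++ʳ (step _ _ p) q m = thereₗ (vertices-++ʳ p q m)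

  Simple : ∀ {U a b} → Path G U a b → Set
  Simple (stop _) = Unit
  Simple (step {a} _ _ p) = a ∉ₗ vertices p × Simple p

  -- A simple path never uses an edge together with its twin (nor is an edge a
  -- loop), because the twin of (c,d) would return to the already visited c.
  simple⇒NoTwins : ∀ {U a b} (p : Path G U a b) → Simple p → NoTwins (edges G p) (edges G p)
  simple⇒NoTwins (step _ e p) _ c d (hereₗ refl) (hereₗ refl) = noLoop G _ e
  simple⇒NoTwins (step _ e p) (a∉p , _) c d (hereₗ refl) (thereₗ m) = a∉p (target∈vertices p m)
  simple⇒NoTwins (step _ e p) (a∉p , _) c d (thereₗ m) (hereₗ refl) = a∉p (target∈vertices p m)
  simple⇒NoTwins (step _ e p) (_ , simple) c d (thereₗ m) (thereₗ m′) =
    simple⇒NoTwins p simple c d m m′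

  prefix : ∀ {U a b z} (p : Path G U a b) → z ∈ₗ vertices p →
    Σ (Path G U a z) λ s → edges G s ⊆ₗ edges G p
  prefix (stop a∈U) (hereₗ refl) = stop a∈U , λ ()
  prefix (step a∈U e p) (hereₗ refl) = stop a∈U , λ ()
  prefix (step a∈U e p) (thereₗ m) with prefix p m
  ... | s , s⊆p = step a∈U e s , ∷⁺ʳ _ s⊆p

  suffix : ∀ {U a b z} (p : Path G U a b) → z ∈ₗ vertices p →
    Σ (Path G U z b) λ s → edges G s ⊆ₗ edges G p × (Simple p → Simple s)
  suffix (stop a∈U) (hereₗ refl) = stop a∈U , ⊆-refl , id
  suffix (step a∈U e p) (hereₗ refl) = step a∈U e p , ⊆-refl , id
  suffix (step a∈U e p) (thereₗ m) with suffix p m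
  ... | s , s⊆p , simple = s , ⊆-trans s⊆p (xs⊆x∷xs _ _) , λ simple-p → simple (proj₂ simple-p)

  -- Every path can be shortened to a simple path along a subset of its edges,
  -- by cutting out the loop at each revisited vertex.
  simplify : ∀ {U a b} (p : Path G U a b) →
    Σ (Path G U a b) λ s → edges G s ⊆ₗ edges G p × Simple s
  simplify (stop a∈U) = stop a∈U , (λ ()) , unit
  simplify (step {a} a∈U e p) with simplify p
  ... | p′ , p′⊆p , simple-p′ = shortcut (a ∈ₗ? vertices p′)
    where
    p′⊆ep : edges G p′ ⊆ₗ edges G (step a∈U e p)
    p′⊆ep = ⊆-trans p′⊆p (xs⊆x∷xs _ _)
    shortcut : Dec (a ∈ₗ vertices p′) →
      Σ (Path G _ a _) λ s → edges G s ⊆ₗ edges G (step a∈U e p) × Simple s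
    shortcut (yes a∈p′) with suffix p′ a∈p′
    ... | s , s⊆p′ , simple-s = s , ⊆-trans s⊆p′ p′⊆ep , simple-s simple-p′
    shortcut (no a∉p′) = step a∈U e p′ , ∷⁺ʳ _ p′⊆p , a∉p′ , simple-p′

  SourcesAvoid TargetsAvoid : Vertices → Edges → Set
  SourcesAvoid S xs = ∀ c d → (c , d) ∈ₗ xs → c ∉ₗ S
  TargetsAvoid S xs = ∀ c d → (c , d) ∈ₗ xs → d ∉ₗ S

  data FirstEntry (S : Vertices) {U w v} (q : Path G U w v) : Set where
    enters : ∀ {y} → y ∈ₗ S → (s : Path G U w y) → edges G s ⊆ₗ edges G q →
      SourcesAvoid S (edges G s) → FirstEntry S q

  firstEntry : ∀ {U w v} (S : Vertices) (q : Path G U w v) → v ∈ₗ S → FirstEntry S q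
  firstEntry S (stop w∈U) v∈S = enters v∈S (stop w∈U) ⊆-refl λ _ _ ()
  firstEntry S (step {a} a∈U e q) v∈S with a ∈ₗ? S
  ... | yes a∈S = enters a∈S (stop a∈U) (λ ()) λ _ _ ()
  ... | no a∉S with firstEntry S q v∈S
  ...   | enters y∈S s s⊆q avoid = enters y∈S (step a∈U e s) (∷⁺ʳ _ s⊆q) avoid′
    where
    avoid′ : SourcesAvoid S (edges G (step a∈U e s))
    avoid′ c d (hereₗ refl) = a∉S
    avoid′ c d (thereₗ m) = avoid c d m

  data LastExit (S : Vertices) {U v w} (p : Path G U v w) : Set where
    exits : ∀ {x} → x ∈ₗ S → (r : Path G U x w) → edges G r ⊆ₗ edges G p →
      TargetsAvoid S (edges G r) → LastExit S p
    avoids : v ∉ₗ S → TargetsAvoid S (edges G p) → LastExit S p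

  lastExit : ∀ {U v w} (S : Vertices) (p : Path G U v w) → LastExit S p
  lastExit {w = w} S (stop w∈U) with w ∈ₗ? S
  ... | yes w∈S = exits w∈S (stop w∈U) ⊆-refl λ _ _ ()
  ... | no w∉S = avoids w∉S λ _ _ ()
  lastExit S (step {a} a∈U e p) with lastExit S p
  ... | exits x∈S r r⊆p avoid = exits x∈S r (⊆-trans r⊆p (xs⊆x∷xs _ _)) avoid
  ... | avoids b∉S avoid = extend (a ∈ₗ? S)
    where
    avoid′ : TargetsAvoid S (edges G (step a∈U e p))
    avoid′ c d (hereₗ refl) = b∉S
    avoid′ c d (thereₗ m) = avoid c d m
    extend : Dec (a ∈ₗ S) → LastExit S (step a∈U e p)
    extend (yes a∈S) = exits a∈S (step a∈U e p) ⊆-refl avoid′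
    extend (no a∉S) = avoids a∉S avoid′

  widen : ∀ {U W a b} → U ⊆ W → Path G U a b → Path G W a b
  widen U⊆W (stop a∈U) = stop (U⊆W a∈U)
  widen U⊆W (step a∈U e p) = step (U⊆W a∈U) e (widen U⊆W p)

  edges-widen : ∀ {U W a b} (U⊆W : U ⊆ W) (p : Path G U a b) → edges G (widen U⊆W p) ≡ edges G p
  edges-widen U⊆W (stop _) = refl
  edges-widen U⊆W (step _ _ p) = cong (_ ∷_) (edges-widen U⊆W p)

  Linked : Subset n → Fin n → Fin n → Set
  Linked U a b = Σ (Path G U a b) λ p → Σ (Path G U b a) λ q → TwinFree G p q

  Linked-widen : ∀ {U W a b} → U ⊆ W → Linked U a b → Linked W a b
  Linked-widen U⊆W (p , q , twinFree) =
    widen U⊆W p , widen U⊆W q ,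
    NoTwins-mono (⊆-reflexive (edges-widen U⊆W p)) (⊆-reflexive (edges-widen U⊆W q)) twinFree

  -- With p′, q′ linking v and w, take the
  -- piece r of p′ after its last visit x to C and the piece s of q′ up to its first
  -- visit y to C; then  C[u..x] ++ r  and  s ++ C[y..u]  are twin-free.
  splice : ∀ {U u v w} (C : Path G U u u) → NoTwins (edges G C) (edges G C) →
    v ∈ₗ vertices C → Linked U v w → Linked U u w
  splice C noTwinsC v∈C (p′ , q′ , twinFree′)
    with lastExit (vertices C) p′ | firstEntry (vertices C) q′ v∈C
  ... | avoids v∉C _ | _ = ⊥-elim (v∉C v∈C)
  ... | exits x∈C r r⊆p′ r-avoids | enters y∈C s s⊆q′ s-avoids
    with prefix C x∈C | suffix C y∈C
  ... | α , α⊆C | β , β⊆C , _ = α ++ₚ r , s ++ₚ β , noTwins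
    where
    noTwins : TwinFree G (α ++ₚ r) (s ++ₚ β)
    noTwins c d m m′ with ∈-edges-++⁻ α r m | ∈-edges-++⁻ s β m′
    ... | inj₁ inα | inj₁ ins = s-avoids d c ins (target∈vertices C (α⊆C inα))
    ... | inj₁ inα | inj₂ inβ = noTwinsC c d (α⊆C inα) (β⊆C inβ)
    ... | inj₂ inr | inj₁ ins = twinFree′ c d (r⊆p′ inr) (s⊆q′ ins)
    ... | inj₂ inr | inj₂ inβ = r-avoids c d inr (source∈vertices C (β⊆C inβ))

  cycle-NoTwins : ∀ {U u v} (p : Path G U u v) (q : Path G U v u) → Simple p → Simple q →
    TwinFree G p q → NoTwins (edges G (p ++ₚ q)) (edges G (p ++ₚ q))
  cycle-NoTwins p q simple-p simple-q twinFree c d m m′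
    with ∈-edges-++⁻ p q m | ∈-edges-++⁻ p q m′
  ... | inj₁ inp | inj₁ inp′ = simple⇒NoTwins p simple-p c d inp inp′
  ... | inj₁ inp | inj₂ inq′ = twinFree c d inp inq′
  ... | inj₂ inq | inj₁ inp′ = twinFree d c inp′ inq
  ... | inj₂ inq | inj₂ inq′ = simple⇒NoTwins q simple-q c d inq inq′

  Linked-trans : ∀ {U u v w} → Linked U u v → Linked U v w → Linked U u w
  Linked-trans (p , q , twinFree) vw with simplify p | simplify q
  ... | p̂ , p̂⊆p , simple-p̂ | q̂ , q̂⊆q , simple-q̂ =
    splice (p̂ ++ₚ q̂)
      (cycle-NoTwins p̂ q̂ simple-p̂ simple-q̂ (NoTwins-mono p̂⊆p q̂⊆q twinFree))
      (vertices-++ʳ p̂ q̂ (start∈vertices q̂)) vw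

  TwinlessSC-resp : ∀ {U W} → U ⊆ W → W ⊆ U → TwinlessSC G U → TwinlessSC G W
  TwinlessSC-resp U⊆W W⊆U tsc a b a∈W b∈W = Linked-widen U⊆W (tsc a b (W⊆U a∈W) (W⊆U b∈W))

  -- The union of two twinless strongly connected sets with a common vertex v is
  -- twinless strongly connected: pairs across the two sets are linked through v.
  TwinlessSC-∪ : ∀ {A B v} → TwinlessSC G A → TwinlessSC G B → v ∈ A → v ∈ B →
    TwinlessSC G (A ∪ B)
  TwinlessSC-∪ {A} {B} {v} tscA tscB v∈A v∈B a b a∈A∪B b∈A∪B
    with x∈p∪q⁻ A B a∈A∪B | x∈p∪q⁻ A B b∈A∪B
  ... | inj₁ a∈A | inj₁ b∈A = Linked-widen (p⊆p∪q B) (tscA a b a∈A b∈A)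
  ... | inj₂ a∈B | inj₂ b∈B = Linked-widen (q⊆p∪q A B) (tscB a b a∈B b∈B)
  ... | inj₁ a∈A | inj₂ b∈B =
    Linked-trans (Linked-widen (p⊆p∪q B) (tscA a v a∈A v∈A))
                 (Linked-widen (q⊆p∪q A B) (tscB v b v∈B b∈B))
  ... | inj₂ a∈B | inj₁ b∈A =
    Linked-trans (Linked-widen (q⊆p∪q A B) (tscB a v a∈B v∈B))
                 (Linked-widen (p⊆p∪q B) (tscA v b v∈A b∈A))

x∈p─q⇒x∉q : ∀ {m} {x : Fin m} (p q : Subset m) → x ∈ p ─ q → x ∉ q
x∈p─q⇒x∉q (inside ∷ p) (outside ∷ q) here ()
x∈p─q⇒x∉q (_ ∷ p) (_ ∷ q) (there x∈p─q) (there x∈q) = x∈p─q⇒x∉q p q x∈p─q x∈q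

x∈p-y⇒x≢y : ∀ {m} {x y : Fin m} (p : Subset m) → x ∈ p - y → x ≢ y
x∈p-y⇒x≢y {x = x} p x∈p-x refl = x∈p─q⇒x∉q p ⁅ x ⁆ x∈p-x (x∈⁅x⁆ x)

∪-x⊆-x∪-x : ∀ {m} (A B : Subset m) (x : Fin m) → (A ∪ B) - x ⊆ (A - x) ∪ (B - x)
∪-x⊆-x∪-x A B x y∈ with x∈p∪q⁻ A B (p─q⊆p (A ∪ B) ⁅ x ⁆ y∈)
... | inj₁ y∈A = x∈p∪q⁺ (inj₁ (x∈p∧x≢y⇒x∈p-y y∈A (x∈p-y⇒x≢y (A ∪ B) y∈)))
... | inj₂ y∈B = x∈p∪q⁺ (inj₂ (x∈p∧x≢y⇒x∈p-y y∈B (x∈p-y⇒x≢y (A ∪ B) y∈)))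

-x∪-x⊆∪-x : ∀ {m} (A B : Subset m) (x : Fin m) → (A - x) ∪ (B - x) ⊆ (A ∪ B) - x
-x∪-x⊆∪-x A B x y∈ with x∈p∪q⁻ (A - x) (B - x) y∈
... | inj₁ y∈A-x = x∈p∧x≢y⇒x∈p-y (p⊆p∪q B (p─q⊆p A ⁅ x ⁆ y∈A-x)) (x∈p-y⇒x≢y A y∈A-x)
... | inj₂ y∈B-x = x∈p∧x≢y⇒x∈p-y (q⊆p∪q A B (p─q⊆p B ⁅ x ⁆ y∈B-x)) (x∈p-y⇒x≢y B y∈B-x)

x∉p⇒p⊆p-x : ∀ {m} {x : Fin m} {p : Subset m} → x ∉ p → p ⊆ p - x
x∉p⇒p⊆p-x x∉p y∈p = x∈p∧x≢y⇒x∈p-y y∈p λ { refl → x∉p y∈p }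

member : ∀ {m} (S : Subset m) → 1 ≤ ∣ S ∣ → Σ (Fin m) λ y → y ∈ S
member (inside ∷ S) _ = Fin.zero , here
member (outside ∷ S) 1≤∣S∣ with member S 1≤∣S∣
... | y , y∈S = Fin.suc y , there y∈S

twoMembers : ∀ {m} (S : Subset m) → 2 ≤ ∣ S ∣ →
  Σ (Fin m) λ y₁ → Σ (Fin m) λ y₂ → y₁ ≢ y₂ × y₁ ∈ S × y₂ ∈ S
twoMembers (inside ∷ S) (s≤s 1≤∣S∣) with member S 1≤∣S∣
... | y , y∈S = Fin.zero , Fin.suc y , (λ ()) , here , there y∈S
twoMembers (outside ∷ S) 2≤∣S∣ with twoMembers S 2≤∣S∣
... | y₁ , y₂ , y₁≢y₂ , y₁∈S , y₂∈S =
  Fin.suc y₁ , Fin.suc y₂ , (λ eq → y₁≢y₂ (suc-injective eq)) , there y₁∈S , there y₂∈S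

memberAvoiding : ∀ {m} (S : Subset m) → 2 ≤ ∣ S ∣ → (x : Fin m) → Σ (Fin m) λ y → y ∈ S × y ≢ x
memberAvoiding S 2≤∣S∣ x with twoMembers S 2≤∣S∣
... | y₁ , y₂ , y₁≢y₂ , y₁∈S , y₂∈S with y₁ ≟ x
...   | no y₁≢x = y₁ , y₁∈S , y₁≢x
...   | yes refl = y₂ , y₂∈S , λ y₂≡y₁ → y₁≢y₂ (sym y₂≡y₁)

module _ {n : ℕ} (G : Digraph n) where

  punctured : ∀ {C} → TwoVTC G C → (x : Fin n) → TwinlessSC G (C - x)
  punctured {C} (tsc , _ , tsc-x) x with x ∈? C
  ... | yes x∈C = tsc-x x x∈C
  ... | no x∉C = TwinlessSC-resp G (x∉p⇒p⊆p-x x∉C) (p─q⊆p C ⁅ x ⁆) tsc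

  -- Two 2-vertex-twinless-connected sets sharing at least two vertices have a
  -- 2-vertex-twinless-connected union: whichever vertex x is deleted, the punctured
  -- sets keep a common vertex, so their union (C₁ ∪ C₂) - x is twinless s.c.
  TwoVTC-∪ : ∀ {C₁ C₂} → TwoVTC G C₁ → TwoVTC G C₂ → 2 ≤ ∣ C₁ ∩ C₂ ∣ → TwoVTC G (C₁ ∪ C₂)
  TwoVTC-∪ {C₁} {C₂} vtc₁@(tsc₁ , 3≤∣C₁∣ , _) vtc₂@(tsc₂ , _ , _) 2≤∣C₁∩C₂∣ =
    tsc , ≤-trans 3≤∣C₁∣ (∣p∣≤∣p∪q∣ C₁ C₂) , tsc-x
    where
    shared : (x : Fin n) → Σ (Fin n) λ y → y ∈ C₁ ∩ C₂ × y ≢ x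
    shared = memberAvoiding (C₁ ∩ C₂) 2≤∣C₁∩C₂∣

    tsc : TwinlessSC G (C₁ ∪ C₂)
    tsc with twoMembers (C₁ ∩ C₂) 2≤∣C₁∩C₂∣
    ... | y , _ , _ , y∈C₁∩C₂ , _ with x∈p∩q⁻ C₁ C₂ y∈C₁∩C₂
    ...   | y∈C₁ , y∈C₂ = TwinlessSC-∪ G tsc₁ tsc₂ y∈C₁ y∈C₂

    tsc-x : ∀ x → x ∈ C₁ ∪ C₂ → TwinlessSC G ((C₁ ∪ C₂) - x)
    tsc-x x _ with shared x
    ... | y , y∈C₁∩C₂ , y≢x with x∈p∩q⁻ C₁ C₂ y∈C₁∩C₂
    ...   | y∈C₁ , y∈C₂ =
      TwinlessSC-resp G (-x∪-x⊆∪-x C₁ C₂ x) (∪-x⊆-x∪-x C₁ C₂ x)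
        (TwinlessSC-∪ G (punctured vtc₁ x) (punctured vtc₂ x)
          (x∈p∧x≢y⇒x∈p-y y∈C₁ y≢x) (x∈p∧x≢y⇒x∈p-y y∈C₂ y≢x))

-- Two distinct components sharing two vertices would both equal their union.
mainTheorem16 : (n : ℕ) (G : Digraph n) → TwinlessSC G ⊤ →
    (C₁ C₂ : Subset n) → TwoVTCComponent G C₁ → TwoVTCComponent G C₂ →
    C₁ ≢ C₂ → ∣ C₁ ∩ C₂ ∣ ≤ 1
mainTheorem16 n G _ C₁ C₂ (vtc₁ , maximal₁) (vtc₂ , maximal₂) C₁≢C₂ with ∣ C₁ ∩ C₂ ∣ ≤? 1
... | yes ∣C₁∩C₂∣≤1 = ∣C₁∩C₂∣≤1
... | no ∣C₁∩C₂∣≰1 = ⊥-elim (C₁≢C₂ (trans (sym ∪≡C₁) ∪≡C₂))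
  where
  vtc∪ : TwoVTC G (C₁ ∪ C₂)
  vtc∪ = TwoVTC-∪ G vtc₁ vtc₂ (≰⇒> ∣C₁∩C₂∣≰1)

  ∪≡C₁ : C₁ ∪ C₂ ≡ C₁
  ∪≡C₁ = maximal₁ (C₁ ∪ C₂) (p⊆p∪q C₂) vtc∪

  ∪≡C₂ : C₁ ∪ C₂ ≡ C₂
  ∪≡C₂ = maximal₂ (C₁ ∪ C₂) (q⊆p∪q C₁ C₂) vtc∪
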